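{- Fix an integer $h\ge1$. Then $\blacktriangle^{\star2}=\blacktriangle\star\blacktriangle=\big(n^p_{[m_1,\dots,m_h]}\big)_{m_1\ge\dots\ge m_h\ge1}$; that is, for every partition $(m_1,\dots,m_h)$ of height $h$, the number of pyramids of height $h$ whose plateau volumes are $m_1,\dots,m_h$ equals $\sum\prod_{i=1}^{h-1}(\lambda_i-\lambda_{i+1}+1)(\lambda'_i-\lambda'_{i+1}+1)$, the sum over pairs of partitions $(\lambda,\lambda')$ of height $h$ with $\lambda_i\lambda'_i=m_i$ for all $i$.
   Context: A partition of height $h$ is a sequence $\lambda_1\ge\dots\ge\lambda_h\ge1$ of integers. $\blacktriangle$ is the family indexed by $h$-tuples of positive integers with entry $(n_1-n_2+1)\cdots(n_{h-1}-n_h+1)$ at $(n_1,\dots,n_h)$ when $n_1\ge\dots\ge n_h$ and $0$ otherwise. For families $A=(a_n),B=(b_n)$ indexed by $h$-tuples of positive integers, $(A\star B)_{n_1,\dots,n_h}=\sum a_{m_1,\dots,m_h}b_{p_1,\dots,p_h}$ over positive integers with $n_i=m_ip_i$ for all $i$. A pyramid of height $h$ is a set of unit cells of $\mathbb Z^3$ of the form $\bigcup_{a=0}^{h-1}\{a\}\times R_a$, where each $R_a=\{b_a,\dots,b_a+p_a-1\}\times\{c_a,\dots,c_a+q_a-1\}$ is a nonempty rectangle of cells ($p_a,q_a\ge1$), $b_0=c_0=0$, and $R_a\subseteq R_{a-1}$ for $1\le a\le h-1$; the $(a+1)$-th plateau is $\{a\}\times R_a$ and has volume $p_aq_a$. $n^p_{[m_1,\dots,m_h]}$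 denotes the number of pyramids of height $h$ whose $i$-th plateau has volume $m_i$ for $i=1,\dots,h$. -}

module Defs where

open import Data.Nat using (ℕ; zero; suc; _+_; _*_; _∸_; _≤_; _≤ᵇ_)
open import Data.Nat.Properties using (_≟_)
open import Data.Bool using (if_then_else_)
open import Data.List using (List; []; _∷_; map; upTo; filter; concatMap)
open import Data.Nat.ListAction using (sum)
open import Data.Vec using (Vec; []; _∷_)
import Data.Vec as V
open import Data.Product using (Σ; _×_; _,_; proj₁; proj₂)
open import Data.Unit using (⊤)
open import Relation.Binary.PropositionalEquality using (_≡_)

-- Families indexed by h-tuples of positive integers are modelled as
-- functions Vec ℕ h → ℕ (only values at positive tuples matter).

Family : ℕ → Set
Family h = Vec ℕ h → ℕ

▲ : ∀ {h} → Family h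
▲ [] = 1
▲ (x ∷ []) = 1
▲ (x ∷ y ∷ v) = if y ≤ᵇ x then (x ∸ y + 1) * ▲ (y ∷ v) else 0

pos≤ : ℕ → List ℕ
pos≤ n = map suc (upTo n)

factorPairs : ℕ → List (ℕ × ℕ)
factorPairs n =
  filter (λ mp → proj₁ mp * proj₂ mp ≟ n)
         (concatMap (λ m → map (λ p → (m , p)) (pos≤ n)) (pos≤ n))

factorTuples : ∀ {h} → Vec ℕ h → List (Vec ℕ h × Vec ℕ h)
factorTuples [] = ([] , []) ∷ []
factorTuples (n ∷ ns) =
  concatMap (λ mp → map (λ uv → (proj₁ mp ∷ proj₁ uv , proj₂ mp ∷ proj₂ uv))
                        (factorTuples ns))
            (factorPairs n)

_⋆_ : ∀ {h} → Family h → Family h → Family h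
(A ⋆ B) n = sum (map (λ uv → A (proj₁ uv) * B (proj₂ uv)) (factorTuples n))

Nonincreasing : ∀ {h} → Vec ℕ h → Set
Nonincreasing [] = ⊤
Nonincreasing (x ∷ []) = ⊤
Nonincreasing (x ∷ y ∷ v) = y ≤ x × Nonincreasing (y ∷ v)

AllPositive : ∀ {h} → Vec ℕ h → Set
AllPositive [] = ⊤
AllPositive (x ∷ v) = 1 ≤ x × AllPositive v

IsPartition : ∀ {h} → Vec ℕ h → Set
IsPartition m = Nonincreasing m × AllPositive m

-- A nonempty rectangle of cells {b,…,b+p-1} × {c,…,c+q-1}.
-- Coordinates are natural numbers: all rectangles are contained in R₀,
-- which has corner (0,0), so no negative coordinates can occur.
record Rect : Set where
  constructor rect
  field
    b c p q : ℕ
    p≥1 : 1 ≤ p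
    q≥1 : 1 ≤ q
open Rect public

_⊆ᴿ_ : Rect → Rect → Set
R ⊆ᴿ S = (b S ≤ b R × b R + p R ≤ b S + p S)
       × (c S ≤ c R × c R + q R ≤ c S + q S)

Nested : ∀ {h} → Vec Rect h → Set
Nested [] = ⊤
Nested (R ∷ []) = ⊤
Nested (R ∷ S ∷ v) = S ⊆ᴿ R × Nested (S ∷ v)

Based : ∀ {h} → Vec Rect h → Set
Based [] = ⊤
Based (R ∷ _) = b R ≡ 0 × c R ≡ 0

vol : Rect → ℕ
vol R = p R * q R

Pyramid : ℕ → Set
Pyramid h = Σ (Vec Rect h) λ Rs → Based Rs × Nested Rs

PyramidWithVolumes : ∀ {h} → Vec ℕ h → Set
PyramidWithVolumes {h} m = Σ (Pyramid h) λ P → V.map vol (proj₁ P) ≡ m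

module Submission where

-- A pyramid with plateau volumes n ∷ ns is a based rectangle R₀ of
-- volume n followed by a chain R₁ ⊇ R₂ ⊇ … of rectangles below R₀ with
-- volumes ns.  We count such chains below a P × Q rectangle by peeling
-- off one layer at a time: a subrectangle of volume n has sides (a , b)
-- with a * b = n, and it can be placed in fits P a * fits Q b ways,
-- where fits P a = P - a + 1 (or 0 if a > P) is exactly the factor that
-- the family ▲ contributes.  Unfolding ▲ ⋆ ▲ one coordinate at a time
-- gives the same recursion, so the number of chains below a P × Q
-- rectangle is chainCount P Q ns, the ▲ ⋆ ▲-style sum with P and Q
-- prepended.
--
-- The bijection never
-- uses that the volumes form a partition: for other tuples both sides
-- are empty.

open import Defs
open import Data.Nat using (ℕ; zero; suc; _+_; _*_; _∸_; _≤_; _<_; _≤ᵇ_; s≤s; z≤n)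
open import Data.Nat.Properties
  using (≤-irrelevant; ≡-irrelevant; _≟_; +-assoc; +-comm; *-comm; *-identityˡ;
         *-zeroʳ; *-distribˡ-+; *-commutativeSemigroup; m≤m*n; m≤m+n; m≤n+m; ≤-trans; ≤-pred; +-cancelˡ-≤;
         +-monoʳ-≤; m+n∸m≡n; m+[n∸m]≡n; m+n≤o⇒m≤o∸n; m≤o∸n⇒m+n≤o; ≤ᵇ⇒≤; ≤⇒≤ᵇ)
open import Data.Bool using (true; false; if_then_else_; T)
open import Data.Unit using (tt)
open import Data.Empty using (⊥-elim)
open import Data.Fin using (Fin; zero; toℕ; fromℕ<)
open import Data.Fin.Properties using (+↔⊎; *↔×; toℕ<n; toℕ-fromℕ<; fromℕ<-toℕ)
open import Data.List using (List; []; _∷_; _++_; map; upTo; applyUpTo; filter; concatMap)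
open import Data.List.Properties using (map-cong; map-∘; map-++; map-applyUpTo)
open import Data.Nat.ListAction using (sum)
open import Data.Nat.ListAction.Properties using (sum-++)
open import Data.Vec using (Vec; []; _∷_)
import Data.Vec as V
open import Data.Vec.Properties using (∷-injectiveˡ; ∷-injectiveʳ)
open import Data.Product using (Σ; _×_; _,_; proj₁; proj₂)
open import Data.Product.Function.Dependent.Propositional using (congˡ)
open import Data.Product.Function.NonDependent.Propositional using (_×-↔_)
open import Data.Sum using (_⊎_; inj₁; inj₂)
open import Data.Sum.Function.Propositional using (_⊎-↔_)
open import Relation.Nullary using (Dec; yes; no; does; Irrelevant)
open import Relation.Binary.PropositionalEquality
  using (_≡_; refl; sym; trans; cong; cong₂; subst; _≗_; module ≡-Reasoning)
open import Algebra.Properties.CommutativeSemigroup *-commutativeSemigroup using (interchange)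
open import Function.Bundles using (_↔_; mk↔ₛ′)
open import Function.Properties.Inverse using (↔-refl; ↔-sym)
open import Function.Related.Propositional using (module EquationalReasoning)

sum-cong : ∀ {A : Set} {f g : A → ℕ} → f ≗ g → ∀ xs → sum (map f xs) ≡ sum (map g xs)
sum-cong f≗g xs = cong sum (map-cong f≗g xs)

sum-concatMap : ∀ {A B : Set} (g : B → ℕ) (f : A → List B) xs →
  sum (map g (concatMap f xs)) ≡ sum (map (λ x → sum (map g (f x))) xs)
sum-concatMap g f [] = refl
sum-concatMap g f (x ∷ xs) = begin
  sum (map g (f x ++ concatMap f xs))               ≡⟨ cong sum (map-++ g (f x) _) ⟩
  sum (map g (f x) ++ map g (concatMap f xs))       ≡⟨ sum-++ (map g (f x)) _ ⟩
  sum (map g (f x)) + sum (map g (concatMap f xs))  ≡⟨ cong (_ +_) (sum-concatMap g f xs) ⟩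
  sum (map g (f x)) + sum (map (λ y → sum (map g (f y))) xs) ∎
  where open ≡-Reasoning

sum-scale : ∀ {A : Set} (c : ℕ) (f : A → ℕ) xs → sum (map (λ x → c * f x) xs) ≡ c * sum (map f xs)
sum-scale c f [] = sym (*-zeroʳ c)
sum-scale c f (x ∷ xs) = trans (cong (c * f x +_) (sum-scale c f xs)) (sym (*-distribˡ-+ c (f x) _))

sum-filter : ∀ {A : Set} {P : A → Set} (P? : ∀ x → Dec (P x)) (g : A → ℕ) xs →
  sum (map g (filter P? xs)) ≡ sum (map (λ x → if does (P? x) then g x else 0) xs)
sum-filter P? g [] = refl
sum-filter P? g (x ∷ xs) with does (P? x)
... | true = cong (g x +_) (sum-filter P? g xs)
... | false = sum-filter P? g xs

Σ-<-suc-↔ : ∀ (P : ℕ → Set) n →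
  (P 0 ⊎ Σ ℕ (λ k → k < n × P (suc k))) ↔ Σ ℕ (λ k → k < suc n × P k)
Σ-<-suc-↔ P n = mk↔ₛ′ to from to∘from from∘to
  where
  to : (P 0 ⊎ Σ ℕ (λ k → k < n × P (suc k))) → Σ ℕ (λ k → k < suc n × P k)
  to (inj₁ x) = 0 , s≤s z≤n , x
  to (inj₂ (k , k<n , x)) = suc k , s≤s k<n , x
  from : Σ ℕ (λ k → k < suc n × P k) → (P 0 ⊎ Σ ℕ (λ k → k < n × P (suc k)))
  from (zero , _ , x) = inj₁ x
  from (suc k , s≤s k<n , x) = inj₂ (k , k<n , x)
  to∘from : ∀ y → to (from y) ≡ y
  to∘from (zero , s≤s z≤n , x) = refl
  to∘from (suc k , s≤s k<n , x) = refl
  from∘to : ∀ x → from (to x) ≡ x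
  from∘to (inj₁ x) = refl
  from∘to (inj₂ _) = refl

Fin-sum-applyUpTo : ∀ (g : ℕ → ℕ) n → Fin (sum (applyUpTo g n)) ↔ Σ ℕ (λ k → k < n × Fin (g k))
Fin-sum-applyUpTo g zero = mk↔ₛ′ (λ ()) (λ { (_ , () , _) }) (λ { (_ , () , _) }) (λ ())
Fin-sum-applyUpTo g (suc n) = begin
  Fin (g 0 + sum (applyUpTo (λ k → g (suc k)) n))            ↔⟨ +↔⊎ ⟩
  (Fin (g 0) ⊎ Fin (sum (applyUpTo (λ k → g (suc k)) n)))     ↔⟨ ↔-refl ⊎-↔ Fin-sum-applyUpTo (λ k → g (suc k)) n ⟩
  (Fin (g 0) ⊎ Σ ℕ (λ k → k < n × Fin (g (suc k))))          ↔⟨ Σ-<-suc-↔ (λ k → Fin (g k)) n ⟩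
  Σ ℕ (λ k → k < suc n × Fin (g k))                           ∎
  where open EquationalReasoning

Fin-sum-upTo : ∀ (g : ℕ → ℕ) n → Fin (sum (map g (upTo n))) ↔ Σ ℕ (λ k → k < n × Fin (g k))
Fin-sum-upTo g n = subst (λ xs → Fin (sum xs) ↔ Σ ℕ (λ k → k < n × Fin (g k)))
                          (sym (map-applyUpTo (λ k → k) g n)) (Fin-sum-applyUpTo g n)

Σ-bounded-↔ : ∀ {P : ℕ → Set} n → (∀ x → P x → x < n) → Σ ℕ (λ x → x < n × P x) ↔ Σ ℕ P
Σ-bounded-↔ {P} n bound = mk↔ₛ′ (λ (x , _ , y) → x , y) (λ (x , y) → x , bound x y , y)
  (λ _ → refl) (λ (x , x<n , y) → cong (λ l → x , l , y) (≤-irrelevant _ x<n))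

Fin-gate-↔ : ∀ {A : Set} (A? : Dec A) → Irrelevant A → ∀ k → Fin (if does A? then k else 0) ↔ (A × Fin k)
Fin-gate-↔ (yes a) irr k = mk↔ₛ′ (a ,_) proj₂ (λ (a′ , y) → cong (_, y) (irr a a′)) (λ _ → refl)
Fin-gate-↔ (no ¬a) irr k = mk↔ₛ′ (λ ()) (λ (a , _) → ⊥-elim (¬a a)) (λ (a , _) → ⊥-elim (¬a a)) (λ ())

factor<ˡ : ∀ i j {n} → suc i * suc j ≡ n → i < n
factor<ˡ i j e = subst (suc i ≤_) e (m≤m*n (suc i) (suc j))

factor<ʳ : ∀ i j {n} → suc i * suc j ≡ n → j < n
factor<ʳ i j e = factor<ˡ j i (trans (*-comm (suc j) (suc i)) e)

sum-factorPairs : ∀ (g : ℕ × ℕ → ℕ) n →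
  sum (map g (factorPairs n)) ≡
  sum (map (λ i → sum (map (λ j → if does (suc i * suc j ≟ n) then g (suc i , suc j) else 0) (upTo n))) (upTo n))
sum-factorPairs g n = begin
  sum (map g (factorPairs n))                                    ≡⟨ sum-filter (λ ab → proj₁ ab * proj₂ ab ≟ n) g pairs ⟩
  sum (map gated pairs)                                          ≡⟨ sum-concatMap gated _ (pos≤ n) ⟩
  sum (map (λ a → sum (map gated (map (a ,_) (pos≤ n)))) (pos≤ n))  ≡⟨ cong sum (sym (map-∘ (upTo n))) ⟩
  sum (map (λ i → sum (map gated (map (suc i ,_) (pos≤ n)))) (upTo n))  ≡⟨ sum-cong inner (upTo n) ⟩
  sum (map (λ i → sum (map (λ j → gated (suc i , suc j)) (upTo n))) (upTo n)) ∎
  where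
  open ≡-Reasoning
  pairs : List (ℕ × ℕ)
  pairs = concatMap (λ a → map (a ,_) (pos≤ n)) (pos≤ n)
  gated : ℕ × ℕ → ℕ
  gated ab = if does (proj₁ ab * proj₂ ab ≟ n) then g ab else 0
  inner : ∀ i → sum (map gated (map (suc i ,_) (pos≤ n))) ≡ sum (map (λ j → gated (suc i , suc j)) (upTo n))
  inner i = cong sum (trans (sym (map-∘ (pos≤ n))) (sym (map-∘ (upTo n))))

Fin-factorPairs-↔ : ∀ (g : ℕ × ℕ → ℕ) n →
  Fin (sum (map g (factorPairs n))) ↔ Σ ℕ λ i → Σ ℕ λ j → suc i * suc j ≡ n × Fin (g (suc i , suc j))
Fin-factorPairs-↔ g n = begin
  Fin (sum (map g (factorPairs n)))
    ≡⟨ cong Fin (sum-factorPairs g n) ⟩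
  Fin (sum (map (λ i → sum (map (λ j → gated i j) (upTo n))) (upTo n)))
    ↔⟨ Fin-sum-upTo _ n ⟩
  Σ ℕ (λ i → i < n × Fin (sum (map (λ j → gated i j) (upTo n))))
    ↔⟨ congˡ (↔-refl ×-↔ Fin-sum-upTo _ n) ⟩
  Σ ℕ (λ i → i < n × Σ ℕ λ j → j < n × Fin (gated i j))
    ↔⟨ congˡ (↔-refl ×-↔ congˡ (↔-refl ×-↔ Fin-gate-↔ (_ ≟ n) ≡-irrelevant _)) ⟩
  Σ ℕ (λ i → i < n × Σ ℕ λ j → j < n × (suc i * suc j ≡ n × Fin (g (suc i , suc j))))
    ↔⟨ congˡ (λ {i} → ↔-refl ×-↔ Σ-bounded-↔ n (λ j (e , _) → factor<ʳ i j e)) ⟩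
  Σ ℕ (λ i → i < n × Σ ℕ λ j → suc i * suc j ≡ n × Fin (g (suc i , suc j)))
    ↔⟨ Σ-bounded-↔ n (λ i (j , e , _) → factor<ˡ i j e) ⟩
  Σ ℕ (λ i → Σ ℕ λ j → suc i * suc j ≡ n × Fin (g (suc i , suc j))) ∎
  where
  open EquationalReasoning
  gated : ℕ → ℕ → ℕ
  gated i j = if does (suc i * suc j ≟ n) then g (suc i , suc j) else 0

fits : ℕ → ℕ → ℕ
fits P a = if a ≤ᵇ P then P ∸ a + 1 else 0

▲-cons : ∀ {k} P a (u : Vec ℕ k) → ▲ (P ∷ a ∷ u) ≡ fits P a * ▲ (a ∷ u)
▲-cons P a u with a ≤ᵇ P
... | true = refl
... | false = refl

+≤⇒<fits : ∀ {P a} d → d + a ≤ P → d < fits P a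
+≤⇒<fits {P} {a} d d+a≤P with a ≤ᵇ P in eq
... | true = subst (d <_) (+-comm 1 (P ∸ a)) (s≤s (m+n≤o⇒m≤o∸n d d+a≤P))
... | false = ⊥-elim (subst T eq (≤⇒≤ᵇ (≤-trans (m≤n+m a d) d+a≤P)))

<fits⇒+≤ : ∀ {P a} d → d < fits P a → d + a ≤ P
<fits⇒+≤ {P} {a} d d<fits with a ≤ᵇ P in eq
... | true = m≤o∸n⇒m+n≤o d (≤ᵇ⇒≤ a P (subst T (sym eq) tt)) (≤-pred (subst (d <_) (+-comm (P ∸ a) 1) d<fits))
... | false with () ← d<fits

Σ-prop-≡ : ∀ {A : Set} {P : A → Set} → (∀ x → Irrelevant (P x)) →
  ∀ {x y} {u : P x} {v : P y} → x ≡ y → _≡_ {A = Σ A P} (x , u) (y , v)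
Σ-prop-≡ irr {x} refl = cong (x ,_) (irr x _ _)

×-≤-irrelevant : ∀ {a b c d} → Irrelevant (a ≤ b × c ≤ d)
×-≤-irrelevant (p , q) (p′ , q′) = cong₂ _,_ (≤-irrelevant p p′) (≤-irrelevant q q′)

Offsets : ℕ → ℕ → ℕ → Set
Offsets B P a = Σ ℕ (λ x → B ≤ x × x + a ≤ B + P)

Offsets-shift-↔ : ∀ B P a → Offsets B P a ↔ Σ ℕ (λ d → d + a ≤ P)
Offsets-shift-↔ B P a = mk↔ₛ′ to from
  (λ (d , _) → Σ-prop-≡ (λ _ → ≤-irrelevant) (m+n∸m≡n B d))
  (λ (x , B≤x , _) → Σ-prop-≡ (λ _ → ×-≤-irrelevant) (m+[n∸m]≡n B≤x))
  where
  to : Offsets B P a → Σ ℕ (λ d → d + a ≤ P)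
  to (x , B≤x , x+a≤) = x ∸ B , +-cancelˡ-≤ B _ _ (subst (_≤ B + P) shift x+a≤)
    where
    shift : x + a ≡ B + (x ∸ B + a)
    shift = trans (cong (_+ a) (sym (m+[n∸m]≡n B≤x))) (+-assoc B (x ∸ B) a)
  from : Σ ℕ (λ d → d + a ≤ P) → Offsets B P a
  from (d , d+a≤P) = B + d , m≤m+n B d , subst (_≤ B + P) (sym (+-assoc B d a)) (+-monoʳ-≤ B d+a≤P)

Offsets-↔ : ∀ B P a → Offsets B P a ↔ Fin (fits P a)
Offsets-↔ B P a = begin
  Offsets B P a              ↔⟨ Offsets-shift-↔ B P a ⟩
  Σ ℕ (λ d → d + a ≤ P)      ↔⟨ mk↔ₛ′ to from to∘from from∘to ⟩
  Fin (fits P a)             ∎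
  where
  open EquationalReasoning
  to : Σ ℕ (λ d → d + a ≤ P) → Fin (fits P a)
  to (d , d+a≤P) = fromℕ< (+≤⇒<fits d d+a≤P)
  from : Fin (fits P a) → Σ ℕ (λ d → d + a ≤ P)
  from i = toℕ i , <fits⇒+≤ (toℕ i) (toℕ<n i)
  to∘from : ∀ i → to (from i) ≡ i
  to∘from i = fromℕ<-toℕ i _
  from∘to : ∀ y → from (to y) ≡ y
  from∘to (d , _) = Σ-prop-≡ (λ _ → ≤-irrelevant) (toℕ-fromℕ< _)

chainCount : ∀ {k} → ℕ → ℕ → Vec ℕ k → ℕ
chainCount P Q ns = sum (map (λ uv → ▲ (P ∷ proj₁ uv) * ▲ (Q ∷ proj₂ uv)) (factorTuples ns))

sum-factorTuples-cons : ∀ {k} n (ns : Vec ℕ k) (g : Vec ℕ (suc k) × Vec ℕ (suc k) → ℕ) →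
  sum (map g (factorTuples (n ∷ ns))) ≡
  sum (map (λ ab → sum (map (λ uv → g (proj₁ ab ∷ proj₁ uv , proj₂ ab ∷ proj₂ uv)) (factorTuples ns))) (factorPairs n))
sum-factorTuples-cons n ns g =
  trans (sum-concatMap g _ (factorPairs n)) (sum-cong (λ _ → cong sum (sym (map-∘ (factorTuples ns)))) (factorPairs n))

chainCount-cons : ∀ {k} P Q n (ns : Vec ℕ k) →
  chainCount P Q (n ∷ ns) ≡
  sum (map (λ ab → (fits P (proj₁ ab) * fits Q (proj₂ ab)) * chainCount (proj₁ ab) (proj₂ ab) ns) (factorPairs n))
chainCount-cons P Q n ns = trans (sum-factorTuples-cons n ns _) (sum-cong layer (factorPairs n))
  where
  layer : ∀ ab → sum (map (λ uv → ▲ (P ∷ proj₁ ab ∷ proj₁ uv) * ▲ (Q ∷ proj₂ ab ∷ proj₂ uv)) (factorTuples ns))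
               ≡ (fits P (proj₁ ab) * fits Q (proj₂ ab)) * chainCount (proj₁ ab) (proj₂ ab) ns
  layer (a , b) = trans
    (sum-cong (λ (us , vs) → trans (cong₂ _*_ (▲-cons P a us) (▲-cons Q b vs))
                                     (interchange (fits P a) (▲ (a ∷ us)) (fits Q b) (▲ (b ∷ vs))))
              (factorTuples ns))
    (sum-scale (fits P a * fits Q b) _ (factorTuples ns))

-- ▲ ⋆ ▲ is the same recursion with one placement for the base rectangle.
▲⋆▲-cons : ∀ {k} n (ns : Vec ℕ k) →
  (▲ ⋆ ▲) (n ∷ ns) ≡ sum (map (λ ab → 1 * chainCount (proj₁ ab) (proj₂ ab) ns) (factorPairs n))
▲⋆▲-cons n ns = trans (sum-factorTuples-cons n ns _) (sum-cong (λ _ → sym (*-identityˡ _)) (factorPairs n))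

box : ℕ → ℕ → ℕ → ℕ → Rect
box x y i j = rect x y (suc i) (suc j) (s≤s z≤n) (s≤s z≤n)

Placements : (Rect → Set) → ℕ → ℕ → Set
Placements Pl i j = Σ ℕ λ x → Σ ℕ λ y → Pl (box x y i j)

Rect-by-shape-↔ : ∀ (Pl : Rect → Set) (Y : ℕ → ℕ → Set) n →
  Σ Rect (λ S → Pl S × vol S ≡ n × Y (p S) (q S)) ↔
  Σ ℕ λ i → Σ ℕ λ j → suc i * suc j ≡ n × (Placements Pl i j × Y (suc i) (suc j))
Rect-by-shape-↔ Pl Y n = mk↔ₛ′ to from (λ _ → refl) from∘to
  where
  to : Σ Rect (λ S → Pl S × vol S ≡ n × Y (p S) (q S)) → _
  to (rect x y (suc i) (suc j) (s≤s z≤n) (s≤s z≤n) , pl , e , w) = i , j , e , (x , y , pl) , w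
  from : (Σ ℕ λ i → Σ ℕ λ j → suc i * suc j ≡ n × (Placements Pl i j × Y (suc i) (suc j))) → _
  from (i , j , e , (x , y , pl) , w) = box x y i j , pl , e , w
  from∘to : ∀ s → from (to s) ≡ s
  from∘to (rect x y (suc i) (suc j) (s≤s z≤n) (s≤s z≤n) , _) = refl

layer-↔ : ∀ (Pl : Rect → Set) (c X : ℕ → ℕ → ℕ) n →
  (∀ i j → Placements Pl i j ↔ Fin (c (suc i) (suc j))) →
  Σ Rect (λ S → Pl S × vol S ≡ n × Fin (X (p S) (q S))) ↔
  Fin (sum (map (λ ab → c (proj₁ ab) (proj₂ ab) * X (proj₁ ab) (proj₂ ab)) (factorPairs n)))
layer-↔ Pl c X n placements = begin
  Σ Rect (λ S → Pl S × vol S ≡ n × Fin (X (p S) (q S)))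
    ↔⟨ Rect-by-shape-↔ Pl (λ a b → Fin (X a b)) n ⟩
  (Σ ℕ λ i → Σ ℕ λ j → suc i * suc j ≡ n × (Placements Pl i j × Fin (X (suc i) (suc j))))
    ↔⟨ congˡ (λ {i} → congˡ (λ {j} → ↔-refl ×-↔ (placements i j ×-↔ ↔-refl))) ⟩
  (Σ ℕ λ i → Σ ℕ λ j → suc i * suc j ≡ n × (Fin (c (suc i) (suc j)) × Fin (X (suc i) (suc j))))
    ↔⟨ congˡ (congˡ (↔-refl ×-↔ ↔-sym *↔×)) ⟩
  (Σ ℕ λ i → Σ ℕ λ j → suc i * suc j ≡ n × Fin (c (suc i) (suc j) * X (suc i) (suc j)))
    ↔⟨ ↔-sym (Fin-factorPairs-↔ _ n) ⟩
  Fin (sum (map (λ ab → c (proj₁ ab) (proj₂ ab) * X (proj₁ ab) (proj₂ ab)) (factorPairs n))) ∎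
  where open EquationalReasoning

-- A subrectangle of R is placed independently along both axes.
subrect-placements-↔ : ∀ R i j → Placements (_⊆ᴿ R) i j ↔ Fin (fits (p R) (suc i) * fits (q R) (suc j))
subrect-placements-↔ R i j = begin
  Placements (_⊆ᴿ R) i j
    ↔⟨ mk↔ₛ′ (λ (x , y , hx , hy) → (x , hx) , (y , hy)) (λ ((x , hx) , (y , hy)) → x , y , hx , hy)
             (λ _ → refl) (λ _ → refl) ⟩
  (Offsets (b R) (p R) (suc i) × Offsets (c R) (q R) (suc j))
    ↔⟨ Offsets-↔ (b R) (p R) (suc i) ×-↔ Offsets-↔ (c R) (q R) (suc j) ⟩
  (Fin (fits (p R) (suc i)) × Fin (fits (q R) (suc j)))
    ↔⟨ ↔-sym *↔× ⟩
  Fin (fits (p R) (suc i) * fits (q R) (suc j)) ∎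
  where open EquationalReasoning

IsBased : Rect → Set
IsBased R = b R ≡ 0 × c R ≡ 0

based-placements-↔ : ∀ i j → Placements IsBased i j ↔ Fin 1
based-placements-↔ i j =
  mk↔ₛ′ (λ _ → zero) (λ _ → 0 , 0 , refl , refl) (λ { zero → refl }) (λ { (0 , 0 , refl , refl) → refl })

Chain : ∀ {k} → Rect → Vec ℕ k → Set
Chain {k} R ns = Σ (Vec Rect k) (λ Rs → Nested (R ∷ Rs) × V.map vol Rs ≡ ns)

chain-uncons-↔ : ∀ {k} R n (ns : Vec ℕ k) → Chain R (n ∷ ns) ↔ Σ Rect (λ S → S ⊆ᴿ R × vol S ≡ n × Chain S ns)
chain-uncons-↔ R n ns = mk↔ₛ′ to from to∘from from∘to
  where
  to : Chain R (n ∷ ns) → Σ Rect (λ S → S ⊆ᴿ R × vol S ≡ n × Chain S ns)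
  to ((S ∷ Rs) , (S⊆R , nested) , vols) = S , S⊆R , ∷-injectiveˡ vols , Rs , nested , ∷-injectiveʳ vols
  from : Σ Rect (λ S → S ⊆ᴿ R × vol S ≡ n × Chain S ns) → Chain R (n ∷ ns)
  from (S , S⊆R , volS , Rs , nested , vols) = (S ∷ Rs) , (S⊆R , nested) , cong₂ _∷_ volS vols
  to∘from : ∀ y → to (from y) ≡ y
  to∘from (S , S⊆R , refl , Rs , nested , refl) = refl
  from∘to : ∀ x → from (to x) ≡ x
  from∘to ((S ∷ Rs) , _ , refl) = refl

pyramid-uncons-↔ : ∀ {k} n (ns : Vec ℕ k) →
  PyramidWithVolumes (n ∷ ns) ↔ Σ Rect (λ R → IsBased R × vol R ≡ n × Chain R ns)
pyramid-uncons-↔ n ns = mk↔ₛ′ to from to∘from from∘to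
  where
  to : PyramidWithVolumes (n ∷ ns) → Σ Rect (λ R → IsBased R × vol R ≡ n × Chain R ns)
  to (((R ∷ Rs) , based , nested) , vols) = R , based , ∷-injectiveˡ vols , Rs , nested , ∷-injectiveʳ vols
  from : Σ Rect (λ R → IsBased R × vol R ≡ n × Chain R ns) → PyramidWithVolumes (n ∷ ns)
  from (R , based , volR , Rs , nested , vols) = ((R ∷ Rs) , based , nested) , cong₂ _∷_ volR vols
  to∘from : ∀ y → to (from y) ≡ y
  to∘from (R , based , refl , Rs , nested , refl) = refl
  from∘to : ∀ x → from (to x) ≡ x
  from∘to (((R ∷ Rs) , _ , _) , refl) = refl

chain-↔ : ∀ {k} (ns : Vec ℕ k) R → Chain R ns ↔ Fin (chainCount (p R) (q R) ns)
chain-↔ [] R = mk↔ₛ′ (λ _ → zero) (λ _ → [] , tt , refl) (λ { zero → refl }) (λ { ([] , tt , refl) → refl })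
chain-↔ (n ∷ ns) R = begin
  Chain R (n ∷ ns)
    ↔⟨ chain-uncons-↔ R n ns ⟩
  Σ Rect (λ S → S ⊆ᴿ R × vol S ≡ n × Chain S ns)
    ↔⟨ congˡ (λ {S} → ↔-refl ×-↔ (↔-refl ×-↔ chain-↔ ns S)) ⟩
  Σ Rect (λ S → S ⊆ᴿ R × vol S ≡ n × Fin (chainCount (p S) (q S) ns))
    ↔⟨ layer-↔ (_⊆ᴿ R) (λ a b → fits (p R) a * fits (q R) b) (λ a b → chainCount a b ns) n
               (subrect-placements-↔ R) ⟩
  Fin (sum (map (λ ab → (fits (p R) (proj₁ ab) * fits (q R) (proj₂ ab)) * chainCount (proj₁ ab) (proj₂ ab) ns)
                (factorPairs n)))
    ≡⟨ cong Fin (sym (chainCount-cons (p R) (q R) n ns)) ⟩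
  Fin (chainCount (p R) (q R) (n ∷ ns)) ∎
  where open EquationalReasoning

lemma3 : (h : ℕ) → 1 ≤ h → (m : Vec ℕ h) → IsPartition m →
    PyramidWithVolumes m ↔ Fin ((▲ ⋆ ▲) m)
lemma3 ._ (s≤s z≤n) (n ∷ ns) _ = begin
  PyramidWithVolumes (n ∷ ns)
    ↔⟨ pyramid-uncons-↔ n ns ⟩
  Σ Rect (λ R → IsBased R × vol R ≡ n × Chain R ns)
    ↔⟨ congˡ (λ {R} → ↔-refl ×-↔ (↔-refl ×-↔ chain-↔ ns R)) ⟩
  Σ Rect (λ R → IsBased R × vol R ≡ n × Fin (chainCount (p R) (q R) ns))
    ↔⟨ layer-↔ IsBased (λ _ _ → 1) (λ a b → chainCount a b ns) n based-placements-↔ ⟩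
  Fin (sum (map (λ ab → 1 * chainCount (proj₁ ab) (proj₂ ab) ns) (factorPairs n)))
    ≡⟨ cong Fin (sym (▲⋆▲-cons n ns)) ⟩
  Fin ((▲ ⋆ ▲) (n ∷ ns)) ∎
  where open EquationalReasoning
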